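{- Let $n,m\ge 2$ and let $(a_{i,j})_{(i,j)\in\mathbb{Z}^2}$ be an array such that $a_{i,j}a_{i+1,j+1}-a_{i,j+1}a_{i+1,j}=1$ for all $i,j$, $a_{i,j+n}=-a_{i,j}$ and $a_{i+m,j}=-a_{i,j}$ for all $i,j$, and $a_{i,j}$ is a positive integer for $0\le i\le m-1$, $0\le j\le n-1$. Let $q=(q_j)$ ($n$-periodic) and $q'=(q'_i)$ ($m$-periodic) be the sequences such that $a_{i,j+1}=q_ja_{i,j}-a_{i,j-1}$ and $a_{i+1,j}=q'_ia_{i,j}-a_{i-1,j}$ for all $i,j$, and write $a=a_{0,0}$, $b=a_{0,1}$, $c=a_{1,0}$, $d=a_{1,1}$. Let $(v_0,\ldots,v_{n-1})$ be a Farey $n$-gon with $v_0=\frac{a}{c}$, $v_1=\frac{b}{d}$, such that for each $j$ the number of triangles incident to $v_j$ equals $q_j$; and let $(v'_0,\ldots,v'_{m-1})$ be a Farey $m$-gon with $v'_0=\frac10$, $v'_{m-1}=\frac01$, such that for each $i$ the number of triangles incident to $v'_i$ equals $q'_{i+1}$ (indices of $q'$ taken mod $m$). Setting $v'_{ -1}:=v'_{m-1}$, one has $$a_{i,j}=d(v'_{i-1},v_j)\qquad\text{for all }0\le i\le m-1,\ 0\le j\le n-1.$$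
   Context: Elements of $\mathbb{Q}\cup\{\infty\}$ are written as irreducible fractions $\frac{p}{r}$ with $r\ge 0$, with $\infty=\frac10$. The Farey distance is $d(\frac{p_1}{r_1},\frac{p_2}{r_2})=|p_1r_2-p_2r_1|$. The Farey graph has vertex set $\mathbb{Q}\cup\{\infty\}$, with an edge between $v_1,v_2$ iff $d(v_1,v_2)=1$. A Farey $n$-gon is a sequence of rationals (or $\infty$) with $\infty\ge v_0>v_1>\cdots>v_{n-1}\ge 0$ such that $v_i,v_{i+1}$ (for $0\le i\le n-2$) and $v_{n-1},v_0$ are joined by edges of the Farey graph. The number of triangles incident to a vertex $v_i$ of a Farey $n$-gon is (the number of vertices $v_k$, $k\ne i$, of the polygon joined to $v_i$ by an edge of the Farey graph) minus $1$; this is the number of triangles at $v_i$ in the triangulation of the polygon given by the Farey edges among its vertices. -}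

module Defs where

open import Data.Nat as ℕ using (ℕ; zero; suc)
open import Data.Nat.Coprimality using (Coprime)
open import Data.Integer as ℤ using (ℤ; +_; ∣_∣; _*_; _-_)
open import Data.Fin as Fin using (Fin; toℕ; fromℕ; inject₁)
open import Data.List using (List; map)
open import Data.Nat.ListAction using (sum)
open import Data.Fin using () renaming (zero to fzero; suc to fsuc)
open import Data.Bool using (Bool; true; false; if_then_else_; not; _∧_)
open import Data.List using (List)
import Data.List as List
open import Relation.Binary.PropositionalEquality using (_≡_)

-- An element of ℚ ∪ {∞} written as an irreducible fraction p/r with r ≥ 0,
-- where ∞ = 1/0 (so -1/0 is excluded).
record Vertex : Set where
  constructor _/_[_,_]
  field
    num   : ℤ
    den   : ℕ
    irred : Coprime ∣ num ∣ den
    inf   : den ≡ 0 → num ≡ + 1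
open Vertex public

fareyDist : Vertex → Vertex → ℕ
fareyDist u v = ∣ num u * (+ den v) - num v * (+ den u) ∣

-- strict order on ℚ ∪ {∞} (valid since denominators are ≥ 0): u < v iff p_u r_v < p_v r_u
_<V_ : Vertex → Vertex → Set
u <V v = num u * (+ den v) ℤ.< num v * (+ den u)

_≤V_ : Vertex → Vertex → Set
u ≤V v = num u * (+ den v) ℤ.≤ num v * (+ den u)

∞V : Vertex
∞V = record { num = + 1 ; den = 0 ; irred = λ {(d1 , _) → Data.Nat.Divisibility.∣1⇒≡1 d1} ; inf = λ _ → Relation.Binary.PropositionalEquality.refl }
  where import Data.Nat.Divisibility
        open import Data.Product using (_,_)

0V : Vertex
0V = record { num = + 0 ; den = 1 ; irred = λ {(_ , d1) → Data.Nat.Divisibility.∣1⇒≡1 d1} ; inf = λ () }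
  where import Data.Nat.Divisibility
        open import Data.Product using (_,_)

prevIdx : ∀ {m} → Fin m → Fin m
prevIdx {suc k} fzero = fromℕ k
prevIdx {suc k} (fsuc i) = inject₁ i

record FareyPolygon (n : ℕ) (v : Fin n → Vertex) : Set where
  field
    decreasing : ∀ (i : Fin n) → 1 ℕ.≤ toℕ i → v i <V v (prevIdx i)
    first≤∞    : ∀ (i : Fin n) → toℕ i ≡ 0 → v i ≤V ∞V
    last≥0     : ∀ (i : Fin n) → suc (toℕ i) ≡ n → 0V ≤V v i
    edges      : ∀ (i : Fin n) → fareyDist (v (prevIdx i)) (v i) ≡ 1

farey-neighbours : ∀ {n} → (Fin n → Vertex) → Fin n → ℕ
farey-neighbours {n} v i =
  sum (map (λ k → if not (toℕ k ℕ.≡ᵇ toℕ i) ∧ (fareyDist (v i) (v k) ℕ.≡ᵇ 1) then 1 else 0)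
           (List.allFin n))

triangles : ∀ {n} → (Fin n → Vertex) → Fin n → ℤ
triangles v i = + farey-neighbours v i - + 1

module Submission where

-- A vertex p/r is treated as the integer vector (p , r), so that the Farey distance
-- is the absolute value of a 2×2 determinant.  The heart of the proof is the fan
-- relation at an interior vertex u of a Farey polygon with neighbours x and y:
--     x + y = T·u,   T = number of triangles at u.
-- Algebraically x + y = (det x y)·u (unimodular-fan).  Combinatorially, the Farey
-- neighbours of u lie on the lines x - l·u and y - l·u; walking along the two arcs
-- of the polygon (PathNeighbours) shows that the polygon contains exactly the points
-- of these lines in the positive quadrant, whence T = det x y (fan-thresholds).
-- A variant at the vertex ∞ of the second polygon gives v'₁ = (q'₁ , 1).
-- The fan relation means the vertex vectors obey the recurrences defining q and q',
-- so rows 0 and 1 of the array are the vectors of v (first-rows), row i + 1 consists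
-- of the determinants against v'ᵢ (columns), and positivity fixes the sign.

open import Defs
open import Data.Nat using (ℕ; suc)
open import Data.Integer using (ℤ; +_; _+_; _-_; _*_; -_; _<_)
open import Data.Fin using (Fin; toℕ; fromℕ; zero; suc)
open import Relation.Binary.PropositionalEquality using (_≡_)

import Data.Nat as N
import Data.Nat.Properties as NP
import Data.Integer as Z
import Data.Integer.Properties as ZP
import Data.Fin as F
import Data.Fin.Properties as FP
import Data.List as List
import Data.List.Properties as ListP
open import Data.Integer using (_≤_; -[1+_]; ∣_∣)
open import Data.Integer.Tactic.RingSolver using (solve-∀)
open import Data.Bool using (Bool; true; false; if_then_else_; not; _∧_; T)
open import Data.Unit using (tt)
open import Data.List using (map)
open import Data.Nat.ListAction using (sum)
open import Data.Product using (Σ; _×_; _,_; proj₁; proj₂)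
open import Data.Sum using (_⊎_; inj₁; inj₂)
open import Data.Empty using (⊥; ⊥-elim)
open import Relation.Nullary using (¬_; Dec; yes; no)
open import Relation.Binary.Definitions using (tri<; tri≈; tri>)
open import Relation.Binary.PropositionalEquality
  using (_≢_; refl; sym; trans; cong; cong₂; subst; subst₂; module ≡-Reasoning)

0<1 : + 0 < + 1
0<1 = Z.+<+ (N.s≤s N.z≤n)

*-nonneg : ∀ {x y} → + 0 ≤ x → + 0 ≤ y → + 0 ≤ x * y
*-nonneg {+ m} {+ n} _ _ rewrite sym (ZP.pos-* m n) = Z.+≤+ N.z≤n

*-pos : ∀ {x y} → + 0 < x → + 0 < y → + 0 < x * y
*-pos {+ suc m} {+ suc n} (Z.+<+ _) (Z.+<+ _) rewrite sym (ZP.pos-* (suc m) (suc n)) = Z.+<+ (N.s≤s N.z≤n)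

pos-factorˡ : ∀ x y → + 0 ≤ y → + 0 < x * y → + 0 < x
pos-factorˡ (+ suc k) y _ _ = Z.+<+ (N.s≤s N.z≤n)
pos-factorˡ (+ 0) y _ h rewrite ZP.*-zeroˡ y = ⊥-elim (ZP.<-irrefl refl h)
pos-factorˡ -[1+ k ] (+ 0) _ h rewrite ZP.*-zeroʳ -[1+ k ] = ⊥-elim (ZP.<-irrefl refl h)
pos-factorˡ -[1+ k ] (+ suc n) _ ()

pos-factorʳ : ∀ x y → + 0 ≤ x → + 0 < x * y → + 0 < y
pos-factorʳ x y p h rewrite ZP.*-comm x y = pos-factorˡ y x p h

pos⇒≥1 : ∀ {x} → + 0 < x → + 1 ≤ x
pos⇒≥1 (Z.+<+ (N.s≤s p)) = Z.+≤+ (N.s≤s p)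

<⇒pos-diff : ∀ {x y} → x < y → + 0 < y - x
<⇒pos-diff {x} {y} p = subst (_< y - x) (ZP.+-inverseʳ x) (ZP.+-monoˡ-< (- x) p)

pos-diff⇒< : ∀ {x y} → + 0 < y - x → x < y
pos-diff⇒< {x} {y} p = subst₂ _<_ (ZP.+-identityˡ x) (cancel y x) (ZP.+-monoˡ-< x p)
  where
  cancel : ∀ a b → a - b + b ≡ a
  cancel = solve-∀

pos+pos≢1 : ∀ x y → + 0 < x → + 0 < y → x + y ≡ + 1 → ⊥
pos+pos≢1 x y hx hy e = ZP.<-irrefl refl (ZP.<-≤-trans (Z.+<+ (N.s≤s (N.s≤s N.z≤n)))
   (subst (+ 2 ≤_) e (ZP.+-mono-≤ (pos⇒≥1 hx) (pos⇒≥1 hy))))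

det1⇒pos-diagonal : ∀ a b c d → a * b - c * d ≡ + 1 → + 0 ≤ c → + 0 ≤ d → + 0 < a * b
det1⇒pos-diagonal a b c d e hc hd =
  subst (+ 0 <_) (undo (a * b) (c * d)) (subst (λ z → + 0 < z + c * d) (sym e) (ZP.+-mono-<-≤ 0<1 (*-nonneg hc hd)))
  where
  undo : ∀ x y → (x - y) + y ≡ x
  undo = solve-∀

pos*pos≡1 : ∀ x y → + 0 < x → + 0 < y → x * y ≡ + 1 → x ≡ + 1
pos*pos≡1 (+ suc k) y _ _ e with NP.m*n≡1⇒m≡1 (suc k) ∣ y ∣ (trans (sym (ZP.abs-* (+ suc k) y)) (cong ∣_∣ e))
... | refl = refl

∣∣≡1⇒≤1 : ∀ x → ∣ x ∣ ≡ 1 → x ≤ + 1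
∣∣≡1⇒≤1 (+ .1) refl = ZP.≤-refl
∣∣≡1⇒≤1 -[1+ 0 ] refl = Z.-≤+

pos∣∣≡1 : ∀ x → + 0 < x → ∣ x ∣ ≡ 1 → x ≡ + 1
pos∣∣≡1 (+ .1) _ refl = refl

pos-±⇒∣∣ : ∀ x y → + 0 < x → x ≡ y ⊎ x ≡ - y → x ≡ + ∣ y ∣
pos-±⇒∣∣ x y hx (inj₁ refl) = sym (ZP.0≤i⇒+∣i∣≡i (ZP.<⇒≤ hx))
pos-±⇒∣∣ x y hx (inj₂ refl) = trans (sym (ZP.0≤i⇒+∣i∣≡i (ZP.<⇒≤ hx))) (cong +_ (ZP.∣-i∣≡∣i∣ y))

count-minus-one : ∀ a b → + (a N.+ suc b) - + 1 ≡ + a + + b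
count-minus-one a b = trans (cong (_- + 1) (ZP.pos-+ a (suc b))) (identity (+ a) (+ b))
  where
  identity : ∀ a b → a + (+ 1 + b) - + 1 ≡ a + b
  identity = solve-∀

Vec2 : Set
Vec2 = ℤ × ℤ

vec : Vertex → Vec2
vec w = (num w , + den w)

-- The determinant; fareyDist u w is definitionally ∣ det (vec u) (vec w) ∣, and
-- for vertices u > w in ℚ≥0 ∪ {∞} the determinant det (vec u) (vec w) is positive.
det : Vec2 → Vec2 → ℤ
det (u₁ , u₂) (w₁ , w₂) = u₁ * w₂ - w₁ * u₂

_⊕_ : Vec2 → Vec2 → Vec2
(u₁ , u₂) ⊕ (w₁ , w₂) = (u₁ + w₁ , u₂ + w₂)

_·_ : ℤ → Vec2 → Vec2
k · (u₁ , u₂) = (k * u₁ , k * u₂)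

neg : Vec2 → Vec2
neg (u₁ , u₂) = (- u₁ , - u₂)

-- Exchanging the coordinates reverses the order of slopes.
swap : Vec2 → Vec2
swap (u₁ , u₂) = (u₂ , u₁)

det-antisym : ∀ u w → det u w ≡ - det w u
det-antisym (u₁ , u₂) (w₁ , w₂) = identity u₁ u₂ w₁ w₂
  where
  identity : ∀ a b c d → a * d - c * b ≡ - (c * b - a * d)
  identity = solve-∀

∣det∣-sym : ∀ u w → ∣ det u w ∣ ≡ ∣ det w u ∣
∣det∣-sym u w = trans (cong ∣_∣ (det-antisym u w)) (ZP.∣-i∣≡∣i∣ (det w u))

det-swap : ∀ u w → det (swap u) (swap w) ≡ det w u
det-swap (u₁ , u₂) (w₁ , w₂) = identity u₁ u₂ w₁ w₂
  where
  identity : ∀ a b c d → b * c - d * a ≡ c * b - a * d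
  identity = solve-∀

det-linear : ∀ x y u z k → x ⊕ y ≡ k · u → det x z + det y z ≡ k * det u z
det-linear (x₁ , x₂) (y₁ , y₂) (u₁ , u₂) (z₁ , z₂) k e = begin
  det (x₁ , x₂) (z₁ , z₂) + det (y₁ , y₂) (z₁ , z₂) ≡⟨ additive x₁ x₂ y₁ y₂ z₁ z₂ ⟩
  det ((x₁ , x₂) ⊕ (y₁ , y₂)) (z₁ , z₂)           ≡⟨ cong (λ w → det w (z₁ , z₂)) e ⟩
  det (k · (u₁ , u₂)) (z₁ , z₂)                   ≡⟨ homogeneous k u₁ u₂ z₁ z₂ ⟩
  k * det (u₁ , u₂) (z₁ , z₂)                      ∎
  where
  open ≡-Reasoning
  additive : ∀ a b c d e f → (a * f - e * b) + (c * f - e * d) ≡ (a + c) * f - e * (b + d)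
  additive = solve-∀
  homogeneous : ∀ k a b e f → (k * a) * f - e * (k * b) ≡ k * (a * f - e * b)
  homogeneous = solve-∀

-- Vectors of the closed positive quadrant other than 0: the vectors of ℚ≥0 ∪ {∞}.
InQuadrant : Vec2 → Set
InQuadrant (u₁ , u₂) = (+ 0 ≤ u₁) × (+ 0 ≤ u₂) × (+ 0 < u₁ + u₂)

inQuadrant? : ∀ u → Dec (InQuadrant u)
inQuadrant? (u₁ , u₂) with + 0 Z.≤? u₁ | + 0 Z.≤? u₂ | + 0 Z.<? u₁ + u₂
... | yes p | yes q | yes r = yes (p , q , r)
... | no ¬p | _     | _     = no (λ z → ¬p (proj₁ z))
... | yes _ | no ¬q | _     = no (λ z → ¬q (proj₁ (proj₂ z)))
... | yes _ | yes _ | no ¬r = no (λ z → ¬r (proj₂ (proj₂ z)))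

inQuadrant-swap : ∀ u → InQuadrant u → InQuadrant (swap u)
inQuadrant-swap (u₁ , u₂) (p , q , r) = q , p , subst (+ 0 <_) (ZP.+-comm u₁ u₂) r

vec-inQuadrant : ∀ w → + 0 ≤ num w → InQuadrant (vec w)
vec-inQuadrant w nn with den w | inf w
... | N.zero | ∞-num = nn , Z.+≤+ N.z≤n , subst (λ z → + 0 < z + + 0) (sym (∞-num refl)) 0<1
... | suc k  | _     = nn , Z.+≤+ N.z≤n , ZP.+-mono-≤-< nn (Z.+<+ (N.s≤s N.z≤n))

det-trans : ∀ x y z → InQuadrant x → InQuadrant y → InQuadrant z →
  + 0 < det x y → + 0 < det y z → + 0 < det x z
det-trans (a , b) (c , d) (e , f) (_ , _ , qx) (_ , _ , qy) (_ , _ , qz) xy yz =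
  pos-factorˡ (det (a , b) (e , f)) (c + d) (ZP.<⇒≤ qy)
    (subst (+ 0 <_) (sym (identity a b c d e f)) (ZP.+-mono-<-≤ (*-pos yz qx) (ZP.<⇒≤ (*-pos xy qz))))
  where
  identity : ∀ a b c d e f →
    (a * f - e * b) * (c + d) ≡ (c * f - e * d) * (a + b) + (a * d - c * b) * (e + f)
  identity = solve-∀

-- Two Farey edges a–c and b–d between vectors in cyclic order d, c, b, a cannot
-- both exist: the Plücker relation would make their product of determinants ≥ 2.
no-crossing : ∀ a b c d → + 0 < det b a → + 0 < det c b → + 0 < det d c → + 0 < det d a →
  ∣ det a c ∣ ≡ 1 → ∣ det b d ∣ ≡ 1 → ⊥
no-crossing (a₁ , a₂) (b₁ , b₂) (c₁ , c₂) (d₁ , d₂) ba cb dc da ac bd =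
  ZP.<-irrefl refl (ZP.<-≤-trans product>1 (∣∣≡1⇒≤1 product ∣product∣≡1))
  where
  product : ℤ
  product = det (a₁ , a₂) (c₁ , c₂) * det (b₁ , b₂) (d₁ , d₂)
  ∣product∣≡1 : ∣ product ∣ ≡ 1
  ∣product∣≡1 = trans (ZP.abs-* (det (a₁ , a₂) (c₁ , c₂)) (det (b₁ , b₂) (d₁ , d₂))) (cong₂ N._*_ ac bd)
  plücker : ∀ a₁ a₂ b₁ b₂ c₁ c₂ d₁ d₂ →
    (a₁ * c₂ - c₁ * a₂) * (b₁ * d₂ - d₁ * b₂) ≡
    (b₁ * a₂ - a₁ * b₂) * (d₁ * c₂ - c₁ * d₂) + (d₁ * a₂ - a₁ * d₂) * (c₁ * b₂ - b₁ * c₂)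
  plücker = solve-∀
  product>1 : + 1 < product
  product>1 = subst (+ 1 <_) (sym (plücker a₁ a₂ b₁ b₂ c₁ c₂ d₁ d₂))
    (ZP.<-≤-trans (Z.+<+ (N.s≤s (N.s≤s N.z≤n)))
      (ZP.+-mono-≤ (pos⇒≥1 (*-pos ba dc)) (pos⇒≥1 (*-pos da cb))))

opposite-inQuadrant : ∀ z u → + 0 < proj₁ u → + 0 < proj₂ u → det z u ≡ + 1 →
  ¬ InQuadrant z → InQuadrant (neg z)
opposite-inQuadrant (+ 0 , + 0) (u₁ , u₂) _ _ e _ with trans (sym (zero-det u₁ u₂)) e
  where
  zero-det : ∀ a b → + 0 * b - a * + 0 ≡ + 0
  zero-det = solve-∀
... | ()
opposite-inQuadrant (+ 0 , + suc l) _ _ _ _ ¬q = ⊥-elim (¬q (Z.+≤+ N.z≤n , Z.+≤+ N.z≤n , Z.+<+ (N.s≤s N.z≤n)))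
opposite-inQuadrant (+ suc k , + r) _ _ _ _ ¬q = ⊥-elim (¬q (Z.+≤+ N.z≤n , Z.+≤+ N.z≤n , Z.+<+ (N.s≤s N.z≤n)))
opposite-inQuadrant (+ 0 , -[1+ l ]) _ _ _ _ _ = Z.+≤+ N.z≤n , Z.+≤+ N.z≤n , Z.+<+ (N.s≤s N.z≤n)
opposite-inQuadrant (-[1+ k ] , + 0) _ _ _ _ _ = Z.+≤+ N.z≤n , Z.+≤+ N.z≤n , Z.+<+ (N.s≤s N.z≤n)
opposite-inQuadrant (-[1+ k ] , -[1+ l ]) _ _ _ _ _ = Z.+≤+ N.z≤n , Z.+≤+ N.z≤n , Z.+<+ (N.s≤s N.z≤n)
opposite-inQuadrant (-[1+ k ] , + suc l) (u₁ , u₂) h₁ h₂ e _ = ⊥-elim (ZP.<-asym 0<1 (subst (_< + 0) e det<0))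
  where
  negative : ∀ a ru pu b → (- a) * ru - pu * b ≡ - (a * ru + pu * b)
  negative = solve-∀
  det<0 : det (-[1+ k ] , + suc l) (u₁ , u₂) < + 0
  det<0 = subst (_< + 0) (sym (negative (+ suc k) u₂ u₁ (+ suc l)))
    (ZP.neg-mono-< (ZP.+-mono-<-≤ (*-pos {+ suc k} (Z.+<+ (N.s≤s N.z≤n)) h₂) (ZP.<⇒≤ (*-pos h₁ (Z.+<+ (N.s≤s N.z≤n))))))
opposite-inQuadrant (+ suc k , -[1+ l ]) (u₁ , u₂) h₁ h₂ e _ =
  ⊥-elim (pos+pos≢1 _ _ (*-pos {+ suc k} (Z.+<+ (N.s≤s N.z≤n)) h₂) (*-pos {u₁} {+ suc l} h₁ (Z.+<+ (N.s≤s N.z≤n)))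
    (trans (sym (positive (+ suc k) u₂ u₁ (+ suc l))) e))
  where
  positive : ∀ a ru pu b → a * ru - pu * (- b) ≡ a * ru + pu * b
  positive = solve-∀

not-both-opposite : ∀ z → InQuadrant z → ¬ InQuadrant (neg z)
not-both-opposite (p , r) (_ , _ , s) (_ , _ , s') =
  ZP.<-irrefl refl (subst (+ 0 <_) (cancel p r) (ZP.+-mono-< s s'))
  where
  cancel : ∀ p r → (p + r) + (- p + - r) ≡ + 0
  cancel = solve-∀

unimodular-fan : ∀ x u y → det x u ≡ + 1 → det u y ≡ + 1 → x ⊕ y ≡ det x y · u
unimodular-fan (x₁ , x₂) (u₁ , u₂) (y₁ , y₂) xu uy =
  cong₂ _,_ (component x₁ u₁ y₁ (expand₁ x₁ x₂ u₁ u₂ y₁ y₂))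
            (component x₂ u₂ y₂ (expand₂ x₁ x₂ u₁ u₂ y₁ y₂))
  where
  open ≡-Reasoning
  expand₁ : ∀ x₁ x₂ u₁ u₂ y₁ y₂ →
    (x₁ * u₂ - u₁ * x₂) * y₁ + (u₁ * y₂ - y₁ * u₂) * x₁ ≡ (x₁ * y₂ - y₁ * x₂) * u₁
  expand₁ = solve-∀
  expand₂ : ∀ x₁ x₂ u₁ u₂ y₁ y₂ →
    (x₁ * u₂ - u₁ * x₂) * y₂ + (u₁ * y₂ - y₁ * u₂) * x₂ ≡ (x₁ * y₂ - y₁ * x₂) * u₂
  expand₂ = solve-∀
  X : Vec2
  X = (x₁ , x₂)
  U : Vec2
  U = (u₁ , u₂)
  Y : Vec2
  Y = (y₁ , y₂)
  component : ∀ a b c → det X U * c + det U Y * a ≡ det X Y * b → a + c ≡ det X Y * b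
  component a b c e = begin
    a + c                          ≡⟨ ZP.+-comm a c ⟩
    c + a                          ≡⟨ sym (cong₂ _+_ (ZP.*-identityˡ c) (ZP.*-identityˡ a)) ⟩
    + 1 * c + + 1 * a              ≡⟨ cong₂ (λ p q → p * c + q * a) (sym xu) (sym uy) ⟩
    det X U * c + det U Y * a      ≡⟨ e ⟩
    det X Y * b                    ∎

fan-centre-positive : ∀ x u y → InQuadrant x → InQuadrant u → InQuadrant y →
  det x u ≡ + 1 → det u y ≡ + 1 → (+ 0 < proj₁ u) × (+ 0 < proj₂ u)
fan-centre-positive (x₁ , x₂) (u₁ , u₂) (y₁ , y₂)
    (x₁≥0 , x₂≥0 , _) (u₁≥0 , u₂≥0 , _) (y₁≥0 , y₂≥0 , _) xu uy =
  pos-factorˡ u₁ y₂ y₂≥0 (det1⇒pos-diagonal u₁ y₂ y₁ u₂ uy y₁≥0 u₂≥0) ,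
  pos-factorʳ x₁ u₂ x₁≥0 (det1⇒pos-diagonal x₁ u₂ u₁ x₂ xu u₁≥0 x₂≥0)

slide : Vec2 → Vec2 → ℤ → Vec2
slide (w₁ , w₂) (u₁ , u₂) l = (w₁ - l * u₁ , w₂ - l * u₂)

slide-antitone : ∀ w u l l' → InQuadrant u → l' ≤ l →
  InQuadrant (slide w u l) → InQuadrant (slide w u l')
slide-antitone (w₁ , w₂) (u₁ , u₂) l l' (u₁≥0 , u₂≥0 , _) l'≤l (p , q , r) =
  subst (+ 0 ≤_) (sym (shift w₁ u₁ l l')) (ZP.+-mono-≤ p (*-nonneg (ZP.i≤j⇒0≤j-i l'≤l) u₁≥0)) ,
  subst (+ 0 ≤_) (sym (shift w₂ u₂ l l')) (ZP.+-mono-≤ q (*-nonneg (ZP.i≤j⇒0≤j-i l'≤l) u₂≥0)) ,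
  subst (+ 0 <_) (sym (shift-sum w₁ w₂ u₁ u₂ l l'))
    (ZP.+-mono-<-≤ r (*-nonneg (ZP.i≤j⇒0≤j-i l'≤l) (ZP.+-mono-≤ u₁≥0 u₂≥0)))
  where
  shift : ∀ x y l l' → x - l' * y ≡ (x - l * y) + (l - l') * y
  shift = solve-∀
  shift-sum : ∀ x₁ x₂ y₁ y₂ l l' →
    (x₁ - l' * y₁) + (x₂ - l' * y₂) ≡ ((x₁ - l * y₁) + (x₂ - l * y₂)) + (l - l') * (y₁ + y₂)
  shift-sum = solve-∀

threshold-unique : (P : ℤ → Set) → (∀ l l' → l' ≤ l → P l → P l') →
  ∀ a b → P a → ¬ P (a + + 1) → P b → ¬ P (b + + 1) → a ≡ b
threshold-unique P closed a b pa ¬pa+1 pb ¬pb+1 with ZP.<-cmp a b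
... | tri< a<b _ _ = ⊥-elim (¬pa+1 (closed b (a + + 1) (subst (_≤ b) (ZP.+-comm (+ 1) a) (ZP.i<j⇒suc[i]≤j a<b)) pb))
... | tri≈ _ a≡b _ = a≡b
... | tri> _ _ b<a = ⊥-elim (¬pb+1 (closed a (b + + 1) (subst (_≤ a) (ZP.+-comm (+ 1) b) (ZP.i<j⇒suc[i]≤j b<a)) pa))

-- For a fan x, u, y (det x u = det u y = 1, u with positive coordinates) the
-- points x - l·u and y - (det x y - l)·u are opposite, so if mU and mL are the last
-- parameters for which these two lines stay in the quadrant, det x y = mU + 1 + mL.
fan-thresholds : ∀ x u y mU mL → InQuadrant u → + 0 < proj₁ u → + 0 < proj₂ u →
  det x u ≡ + 1 → det u y ≡ + 1 →
  InQuadrant (slide x u (+ mU)) → ¬ InQuadrant (slide x u (+ suc mU)) →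
  InQuadrant (slide y u (+ mL)) → ¬ InQuadrant (slide y u (+ suc mL)) →
  det x y ≡ + suc mU + + mL
fan-thresholds x u y mU mL u-quad u₁>0 u₂>0 xu uy xU ¬xU+1 yL ¬yL+1 = begin
  k                          ≡⟨ undo k (+ suc mU) ⟩
  (k - + suc mU) + + suc mU  ≡⟨ cong (_+ + suc mU) last-y ⟩
  + mL + + suc mU            ≡⟨ ZP.+-comm (+ mL) (+ suc mU) ⟩
  + suc mU + + mL            ∎
  where
  open ≡-Reasoning
  k : ℤ
  k = det x y
  undo : ∀ a b → a ≡ (a - b) + b
  undo = solve-∀
  opposite : ∀ l → neg (slide x u l) ≡ slide y u (k - l)
  opposite l = cong₂ _,_ (reflect (proj₁ x) (proj₁ y) (proj₁ u) l (cong proj₁ (unimodular-fan x u y xu uy)))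
                         (reflect (proj₂ x) (proj₂ y) (proj₂ u) l (cong proj₂ (unimodular-fan x u y xu uy)))
    where
    reflect : ∀ a b c l → a + b ≡ k * c → - (a - l * c) ≡ b - (k - l) * c
    reflect a b c l e = begin
      - (a - l * c)                              ≡⟨ regroup a b c k l ⟩
      b - (k - l) * c + (k * c - (a + b))        ≡⟨ cong (λ z → b - (k - l) * c + (k * c - z)) e ⟩
      b - (k - l) * c + (k * c - k * c)          ≡⟨ cong (λ z → b - (k - l) * c + z) (ZP.+-inverseʳ (k * c)) ⟩
      b - (k - l) * c + + 0                      ≡⟨ ZP.+-identityʳ _ ⟩
      b - (k - l) * c                            ∎
      where
      regroup : ∀ a b c k l → - (a - l * c) ≡ b - (k - l) * c + (k * c - (a + b))
      regroup = solve-∀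
  det-slide-u : ∀ l → det (slide x u l) u ≡ + 1
  det-slide-u l = trans (invariant (proj₁ x) (proj₂ x) (proj₁ u) (proj₂ u) l) xu
    where
    invariant : ∀ x₁ x₂ u₁ u₂ l → (x₁ - l * u₁) * u₂ - u₁ * (x₂ - l * u₂) ≡ x₁ * u₂ - u₁ * x₂
    invariant = solve-∀
  y-in : InQuadrant (slide y u (k - + suc mU))
  y-in = subst InQuadrant (opposite (+ suc mU))
           (opposite-inQuadrant (slide x u (+ suc mU)) u u₁>0 u₂>0 (det-slide-u (+ suc mU)) ¬xU+1)
  y-out : ¬ InQuadrant (slide y u (k - + suc mU + + 1))
  y-out yin = not-both-opposite (slide x u (+ mU)) xU
    (subst InQuadrant (sym (trans (opposite (+ mU)) (cong (slide y u) (step k (+ mU))))) yin)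
    where
    step : ∀ k m → k - m ≡ k - (+ 1 + m) + + 1
    step = solve-∀
  last-y : k - + suc mU ≡ + mL
  last-y = threshold-unique (λ l → InQuadrant (slide y u l)) (λ l l' → slide-antitone y u l l' u-quad)
    _ _ y-in y-out yL (λ yin → ¬yL+1 (subst (λ z → InQuadrant (slide y u (+ z))) (NP.+-comm mL 1) yin))

-- If A, A' > 0 and A B' - A' B = 1 then B/A < B'/A' and no integer lies strictly
-- between the two fractions: an integer m ≤ B/A is < B'/A', and B/A < M gives B'/A' ≤ M.
ratio-step-lower : ∀ A A' B B' m → + 0 < A → + 0 < A' → A * B' - A' * B ≡ + 1 →
  m * A ≤ B → m * A' < B'
ratio-step-lower A A' B B' m hA hA' e lo = pos-diff⇒< (pos-factorʳ A (B' - m * A') (ZP.<⇒≤ hA)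
  (subst (+ 0 <_) (sym (identity A A' B B' m))
    (subst (λ t → + 0 < t + (B - m * A) * A') (sym e) (ZP.+-mono-<-≤ 0<1 (*-nonneg (ZP.i≤j⇒0≤j-i lo) (ZP.<⇒≤ hA'))))))
  where
  identity : ∀ A A' B B' m → A * (B' - m * A') ≡ (A * B' - A' * B) + (B - m * A) * A'
  identity = solve-∀

ratio-step-upper : ∀ A A' B B' M → + 0 < A → + 0 < A' → A * B' - A' * B ≡ + 1 →
  B < M * A → B' ≤ M * A'
ratio-step-upper A A' B B' M hA hA' e hi = ZP.≮⇒≥ λ lt →
  pos+pos≢1 _ _ (*-pos hA (<⇒pos-diff lt)) (*-pos (<⇒pos-diff hi) hA') (trans (sym (identity A A' B B' M)) e)
  where
  identity : ∀ A A' B B' M → A * B' - A' * B ≡ A * (B' - M * A') + (M * A - B) * A'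
  identity = solve-∀

Σ< : ℕ → (ℕ → ℕ) → ℕ
Σ< N.zero f = 0
Σ< (suc n) f = Σ< n f N.+ f n

Σ<-shift : ∀ n f → Σ< (suc n) f ≡ f 0 N.+ Σ< n (λ t → f (suc t))
Σ<-shift N.zero f = sym (NP.+-identityʳ (f 0))
Σ<-shift (suc n) f = trans (cong (N._+ f (suc n)) (Σ<-shift n f)) (NP.+-assoc (f 0) _ _)

Σ<-split : ∀ a b f → Σ< (a N.+ b) f ≡ Σ< a f N.+ Σ< b (λ t → f (t N.+ a))
Σ<-split a N.zero f rewrite NP.+-identityʳ a = sym (NP.+-identityʳ (Σ< a f))
Σ<-split a (suc b) f rewrite NP.+-suc a b =
  trans (cong₂ N._+_ (Σ<-split a b f) (cong f (NP.+-comm a b))) (NP.+-assoc (Σ< a f) _ _)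

Σ<-reverse : ∀ n f → Σ< n f ≡ Σ< n (λ t → f (n N.∸ suc t))
Σ<-reverse N.zero f = refl
Σ<-reverse (suc n) f =
  trans (NP.+-comm (Σ< n f) (f n))
   (trans (cong (f n N.+_) (Σ<-reverse n f)) (sym (Σ<-shift n (λ t → f (n N.∸ t)))))

Σ<-cong : ∀ n f g → (∀ t → t N.< n → f t ≡ g t) → Σ< n f ≡ Σ< n g
Σ<-cong N.zero f g _ = refl
Σ<-cong (suc n) f g f≗g = cong₂ N._+_ (Σ<-cong n f g (λ t lt → f≗g t (NP.m≤n⇒m≤1+n lt))) (f≗g n NP.≤-refl)

indicator : Bool → ℕ
indicator b = if b then 1 else 0

indicator-one : ∀ x → x ≡ + 1 → indicator (∣ x ∣ N.≡ᵇ 1) ≡ 1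
indicator-one .(+ 1) refl = refl

indicator-not-one : ∀ x → + 0 < x → ¬ (x ≡ + 1) → indicator (∣ x ∣ N.≡ᵇ 1) ≡ 0
indicator-not-one (+ N.zero) (Z.+<+ ()) _
indicator-not-one (+ suc N.zero) _ x≢1 = ⊥-elim (x≢1 refl)
indicator-not-one (+ suc (suc k)) _ _ = refl

≡ᵇ-refl : ∀ a → (a N.≡ᵇ a) ≡ true
≡ᵇ-refl N.zero = refl
≡ᵇ-refl (suc a) = ≡ᵇ-refl a

≢⇒≡ᵇ-false : ∀ a b → a ≢ b → (a N.≡ᵇ b) ≡ false
≢⇒≡ᵇ-false a b a≢b with a N.≡ᵇ b in eq
... | false = refl
... | true = ⊥-elim (a≢b (NP.≡ᵇ⇒≡ a b (subst T (sym eq) tt)))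

sum-allFin : ∀ n (f : Fin n → ℕ) (g : ℕ → ℕ) → (∀ k → f k ≡ g (toℕ k)) →
  sum (map f (List.allFin n)) ≡ Σ< n g
sum-allFin n f g f≗g = trans (cong sum (ListP.map-tabulate (λ k → k) f)) (tabulated n f g f≗g)
  where
  tabulated : ∀ n (f : Fin n → ℕ) (g : ℕ → ℕ) → (∀ k → f k ≡ g (toℕ k)) → sum (List.tabulate f) ≡ Σ< n g
  tabulated N.zero f g _ = refl
  tabulated (suc n) f g f≗g =
    trans (cong₂ N._+_ (f≗g zero) (tabulated n (λ k → f (suc k)) (λ t → g (suc t)) (λ k → f≗g (suc k))))
          (sym (Σ<-shift n g))

-- Counting the Farey neighbours of u along a Farey path w 0, …, w K that lies
-- clockwise after u and starts at a neighbour of u.  Every c with det u c = 1 is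
-- on the line c l = w 0 - l·u; the path passes c 0, c 1, … in this order, and if
-- no further neighbour of u lies beyond w K, it passes exactly those in the quadrant.
module PathNeighbours (u : Vec2) (w : ℕ → Vec2) (K : ℕ) (u-quad : InQuadrant u)
  (w-quad : ∀ t → t N.≤ K → InQuadrant (w t))
  (w-edge : ∀ t → t N.< K → det (w t) (w (suc t)) ≡ + 1)
  (w-after : ∀ t → t N.≤ K → + 0 < det u (w t))
  (w-start : det u (w 0) ≡ + 1) where

  open ≡-Reasoning

  -- The coordinates of w t in the basis (w 0 , u), up to the common factor.
  A : ℕ → ℤ
  A t = det u (w t)

  B : ℕ → ℤ
  B t = det (w 0) (w t)

  isNeighbour : ℕ → ℕ
  isNeighbour t = indicator (∣ A t ∣ N.≡ᵇ 1)

  c : ℤ → Vec2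
  c l = slide (w 0) u l

  det-u-c : ∀ l → det u (c l) ≡ + 1
  det-u-c l = trans (identity (proj₁ u) (proj₂ u) (proj₁ (w 0)) (proj₂ (w 0)) l) w-start
    where
    identity : ∀ u₁ u₂ x₁ x₂ l → u₁ * (x₂ - l * u₂) - (x₁ - l * u₁) * u₂ ≡ u₁ * x₂ - x₁ * u₂
    identity = solve-∀

  det-w-c : ∀ t l → det (w t) (c l) ≡ l * A t - B t
  det-w-c t l = identity (proj₁ u) (proj₂ u) (proj₁ (w 0)) (proj₂ (w 0)) (proj₁ (w t)) (proj₂ (w t)) l
    where
    identity : ∀ u₁ u₂ x₁ x₂ w₁ w₂ l →
      w₁ * (x₂ - l * u₂) - (x₁ - l * u₁) * w₂ ≡ l * (u₁ * w₂ - w₁ * u₂) - (x₁ * w₂ - w₁ * x₂)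
    identity = solve-∀

  -- Consecutive path vectors give unimodular coordinate pairs (Plücker relation).
  A-B-step : ∀ t → t N.< K → A t * B (suc t) - A (suc t) * B t ≡ + 1
  A-B-step t t<K = trans (sym (plücker (proj₁ u) (proj₂ u) (proj₁ (w 0)) (proj₂ (w 0))
                                (proj₁ (w t)) (proj₂ (w t)) (proj₁ (w (suc t))) (proj₂ (w (suc t)))))
                         (cong₂ _*_ w-start (w-edge t t<K))
    where
    plücker : ∀ u₁ u₂ x₁ x₂ w₁ w₂ y₁ y₂ →
      (u₁ * x₂ - x₁ * u₂) * (w₁ * y₂ - y₁ * w₂) ≡
      (u₁ * w₂ - w₁ * u₂) * (x₁ * y₂ - y₁ * x₂) - (u₁ * y₂ - y₁ * u₂) * (x₁ * w₂ - w₁ * x₂)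
    plücker = solve-∀

  neighbour-on-line : ∀ t → A t ≡ + 1 → w t ≡ c (B t)
  neighbour-on-line t At≡1 = cong₂ _,_
    (coordinate (proj₁ (w t)) (proj₁ (w 0)) (proj₁ u)
      (expand₁ (proj₁ u) (proj₂ u) (proj₁ (w 0)) (proj₂ (w 0)) (proj₁ (w t)) (proj₂ (w t))))
    (coordinate (proj₂ (w t)) (proj₂ (w 0)) (proj₂ u)
      (expand₂ (proj₁ u) (proj₂ u) (proj₁ (w 0)) (proj₂ (w 0)) (proj₁ (w t)) (proj₂ (w t))))
    where
    expand₁ : ∀ u₁ u₂ x₁ x₂ y₁ y₂ →
      (u₁ * x₂ - x₁ * u₂) * y₁ ≡ (u₁ * y₂ - y₁ * u₂) * x₁ - (x₁ * y₂ - y₁ * x₂) * u₁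
    expand₁ = solve-∀
    expand₂ : ∀ u₁ u₂ x₁ x₂ y₁ y₂ →
      (u₁ * x₂ - x₁ * u₂) * y₂ ≡ (u₁ * y₂ - y₁ * u₂) * x₂ - (x₁ * y₂ - y₁ * x₂) * u₂
    expand₂ = solve-∀
    coordinate : ∀ y x v → A 0 * y ≡ A t * x - B t * v → y ≡ x - B t * v
    coordinate y x v e = begin
      y                   ≡⟨ sym (ZP.*-identityˡ y) ⟩
      + 1 * y             ≡⟨ cong (_* y) (sym w-start) ⟩
      A 0 * y             ≡⟨ e ⟩
      A t * x - B t * v   ≡⟨ cong (λ z → z * x - B t * v) At≡1 ⟩
      + 1 * x - B t * v   ≡⟨ cong (_- B t * v) (ZP.*-identityˡ x) ⟩
      x - B t * v         ∎

  -- After step t the path has met exactly the neighbours c 0, …, c m: the last one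
  -- is reached (det (w t) (c m) ≤ 0) and the next one, if in the quadrant, is not.
  record Invariant (t m : ℕ) : Set where
    field
      count    : Σ< (suc t) isNeighbour ≡ suc m
      reached  : InQuadrant (c (+ m))
      passed   : + m * A t ≤ B t
      upcoming : InQuadrant (c (+ suc m)) → B t < + suc m * A t

  invariant-start : Invariant 0 0
  invariant-start = record
    { count    = indicator-one (A 0) w-start
    ; reached  = subst InQuadrant (sym c0≡w0) (w-quad 0 N.z≤n)
    ; passed   = subst₂ _≤_ (sym (ZP.*-zeroˡ (A 0))) (sym B0≡0) ZP.≤-refl
    ; upcoming = λ _ → subst₂ _<_ (sym B0≡0) (sym (trans (ZP.*-identityˡ (A 0)) w-start)) 0<1
    }
    where
    B0≡0 : B 0 ≡ + 0
    B0≡0 = self (proj₁ (w 0)) (proj₂ (w 0))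
      where
      self : ∀ a b → a * b - a * b ≡ + 0
      self = solve-∀
    c0≡w0 : c (+ 0) ≡ w 0
    c0≡w0 = cong₂ _,_ (unshifted (proj₁ (w 0)) (proj₁ u)) (unshifted (proj₂ (w 0)) (proj₂ u))
      where
      unshifted : ∀ x y → x - + 0 * y ≡ x
      unshifted = solve-∀

  -- One step along the path: w (suc t) either is the next neighbour c (m + 1) or
  -- lies strictly between c m and c (m + 1).
  module Step (t m : ℕ) (t<K : suc t N.≤ K) (inv : Invariant t m) where
    open Invariant inv

    A>0 : + 0 < A t
    A>0 = w-after t (NP.<⇒≤ t<K)

    A'>0 : + 0 < A (suc t)
    A'>0 = w-after (suc t) t<K

    m-passed : + m * A (suc t) < B (suc t)
    m-passed = ratio-step-lower (A t) (A (suc t)) (B t) (B (suc t)) (+ m) A>0 A'>0 (A-B-step t t<K) passed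

    beyond-m : A (suc t) ≡ + 1 → + m < B (suc t)
    beyond-m e = subst (_< B (suc t)) (trans (cong (+ m *_) e) (ZP.*-identityʳ (+ m))) m-passed

    stay : ¬ (A (suc t) ≡ + 1) → (InQuadrant (c (+ suc m)) → B (suc t) < + suc m * A (suc t)) →
           Invariant (suc t) m
    stay ¬nb up = record
      { count    = trans (cong₂ N._+_ count (indicator-not-one (A (suc t)) A'>0 ¬nb)) (NP.+-identityʳ (suc m))
      ; reached  = reached
      ; passed   = ZP.<⇒≤ m-passed
      ; upcoming = up
      }

    advance : InQuadrant (c (+ suc m)) → B (suc t) ≡ + suc m * A (suc t) → Invariant (suc t) (suc m)
    advance next at = record
      { count    = trans (cong₂ N._+_ count (indicator-one (A (suc t)) neighbour)) (NP.+-comm (suc m) 1)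
      ; reached  = next
      ; passed   = ZP.≤-reflexive (sym at)
      ; upcoming = λ _ → pos-diff⇒< (subst (λ z → + 0 < + suc (suc m) * A (suc t) - z) (sym at)
                           (subst (+ 0 <_) (sym (one-more (+ suc m) (A (suc t)))) A'>0))
      }
      where
      one-more : ∀ M a → (+ 1 + M) * a - M * a ≡ a
      one-more = solve-∀
      factor : ∀ A A' B M → A * (M * A') - A' * B ≡ A' * (M * A - B)
      factor = solve-∀
      -- A (suc t) divides the unimodular determinant, hence equals 1.
      neighbour : A (suc t) ≡ + 1
      neighbour = pos*pos≡1 (A (suc t)) (+ suc m * A t - B t) A'>0 (<⇒pos-diff (upcoming next))
        (trans (sym (factor (A t) (A (suc t)) (B t) (+ suc m)))
          (subst (λ z → A t * z - A (suc t) * B t ≡ + 1) at (A-B-step t t<K)))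

    step : Σ ℕ (Invariant (suc t))
    step with inQuadrant? (c (+ suc m))
    ... | no ¬next = m , stay not-neighbour (λ next → ⊥-elim (¬next next))
      where
      not-neighbour : ¬ (A (suc t) ≡ + 1)
      not-neighbour e = ¬next (slide-antitone (w 0) u (B (suc t)) (+ suc m) u-quad
        (ZP.i<j⇒suc[i]≤j (beyond-m e)) (subst InQuadrant (neighbour-on-line (suc t) e) (w-quad (suc t) t<K)))
    ... | yes next with ZP.<-cmp (B (suc t)) (+ suc m * A (suc t))
    ...   | tri< before _ _ = m , stay not-neighbour (λ _ → before)
      where
      not-neighbour : ¬ (A (suc t) ≡ + 1)
      not-neighbour e = ZP.<-irrefl refl (ZP.≤-<-trans (ZP.i<j⇒suc[i]≤j (beyond-m e))
        (subst (B (suc t) <_) (trans (cong (+ suc m *_) e) (ZP.*-identityʳ (+ suc m))) before))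
    ...   | tri≈ _ at _ = suc m , advance next at
    ...   | tri> _ _ after = ⊥-elim (ZP.<⇒≱ after (ratio-step-upper (A t) (A (suc t)) (B t) (B (suc t)) (+ suc m)
                               A>0 A'>0 (A-B-step t t<K) (upcoming next)))

  invariant : ∀ t → t N.≤ K → Σ ℕ (Invariant t)
  invariant N.zero _ = 0 , invariant-start
  invariant (suc t) t<K with invariant t (NP.<⇒≤ t<K)
  ... | m , inv = Step.step t m t<K inv

  count-neighbours : (∀ d → InQuadrant d → det u d ≡ + 1 → + 0 < det (w K) d → ⊥) →
    Σ ℕ λ m → (Σ< (suc K) isNeighbour ≡ suc m) × InQuadrant (c (+ m)) × ¬ InQuadrant (c (+ suc m))
  count-neighbours nothing-beyond with invariant K NP.≤-refl
  ... | m , inv = m , count , reached , λ next →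
        nothing-beyond (c (+ suc m)) next (det-u-c (+ suc m))
          (subst (+ 0 <_) (sym (det-w-c K (+ suc m))) (<⇒pos-diff (upcoming next)))
    where open Invariant inv

-- Vertex vectors of a polygon, indexed by ℕ (the zero vector outside the range).
vertexAt : ∀ {N} → (Fin N → Vertex) → ℕ → Vec2
vertexAt {N} v t with t N.<? N
... | yes t<N = vec (v (F.fromℕ< t<N))
... | no _    = (+ 0 , + 0)

vertexAt-< : ∀ {N} (v : Fin N → Vertex) t (t<N : t N.< N) → vertexAt v t ≡ vec (v (F.fromℕ< t<N))
vertexAt-< {N} v t t<N with t N.<? N
... | yes _    = refl
... | no  t≮N  = ⊥-elim (t≮N t<N)

vertexAt-toℕ : ∀ {N} (v : Fin N → Vertex) (i : Fin N) → vertexAt v (toℕ i) ≡ vec (v i)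
vertexAt-toℕ v i = trans (vertexAt-< v (toℕ i) (FP.toℕ<n i)) (cong (λ j → vec (v j)) (FP.fromℕ<-toℕ i (FP.toℕ<n i)))

vertexAt-index : ∀ {N} (v : Fin N → Vertex) (i : Fin N) t → toℕ i ≡ t → vertexAt v t ≡ vec (v i)
vertexAt-index v i t refl = vertexAt-toℕ v i

module PolygonVectors (N₁ : ℕ) (v : Fin (suc N₁) → Vertex) (poly : FareyPolygon (suc N₁) v) where
  open FareyPolygon poly

  V : ℕ → Vec2
  V = vertexAt v

  den-nonneg : ∀ t → t N.< suc N₁ → + 0 ≤ proj₂ (V t)
  den-nonneg t t<N rewrite vertexAt-< v t t<N = Z.+≤+ N.z≤n

  edge : ∀ t → suc t N.< suc N₁ → det (V t) (V (suc t)) ≡ + 1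
  edge t t+1<N = subst₂ (λ a b → det a b ≡ + 1) (sym (vertexAt-index v (F.inject₁ i) t toℕ-inject))
                   (sym (vertexAt-index v (suc i) (suc t) (cong suc toℕ-i)))
                   (pos∣∣≡1 _ (<⇒pos-diff (decreasing (suc i) (N.s≤s N.z≤n))) (edges (suc i)))
    where
    i : Fin N₁
    i = F.fromℕ< (N.s≤s⁻¹ t+1<N)
    toℕ-i : toℕ i ≡ t
    toℕ-i = FP.toℕ-fromℕ< (N.s≤s⁻¹ t+1<N)
    toℕ-inject : toℕ (F.inject₁ i) ≡ t
    toℕ-inject = trans (FP.toℕ-inject₁ i) toℕ-i

  closing-edge : ∣ det (V N₁) (V 0) ∣ ≡ 1
  closing-edge = subst₂ (λ a b → ∣ det a b ∣ ≡ 1) (sym (vertexAt-index v (fromℕ N₁) N₁ (FP.toℕ-fromℕ N₁)))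
                   (sym (vertexAt-toℕ v zero)) (edges zero)

  -- Numerators are nonnegative: the last one is, and det (V t) (V (t + 1)) = 1
  -- forces p_t r_{t+1} > p_{t+1} r_t ≥ 0.
  num-nonneg : ∀ d t → t N.+ d ≡ N₁ → + 0 ≤ proj₁ (V t)
  num-nonneg N.zero t t≡N₁ rewrite trans (sym (NP.+-identityʳ t)) t≡N₁ =
    subst (λ z → + 0 ≤ proj₁ z) (sym (vertexAt-index v (fromℕ N₁) N₁ (FP.toℕ-fromℕ N₁)))
      (subst₂ _≤_ (ZP.*-zeroˡ (+ den (v (fromℕ N₁)))) (ZP.*-identityʳ (num (v (fromℕ N₁))))
        (last≥0 (fromℕ N₁) (cong suc (FP.toℕ-fromℕ N₁))))
  num-nonneg (suc d) t t+d+1≡N₁ = ZP.<⇒≤ (pos-factorˡ (proj₁ (V t)) (proj₂ (V (suc t))) (den-nonneg (suc t) t+1<N)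
      (det1⇒pos-diagonal (proj₁ (V t)) (proj₂ (V (suc t))) (proj₁ (V (suc t))) (proj₂ (V t))
        (edge t t+1<N) (num-nonneg d (suc t) (trans (sym (NP.+-suc t d)) t+d+1≡N₁)) (den-nonneg t (NP.<⇒≤ t+1<N))))
    where
    t+1<N : suc t N.< suc N₁
    t+1<N = N.s≤s (subst (suc t N.≤_) (trans (sym (NP.+-suc t d)) t+d+1≡N₁) (N.s≤s (NP.m≤m+n t d)))

  inQuadrant : ∀ t → t N.< suc N₁ → InQuadrant (V t)
  inQuadrant t t<N = subst InQuadrant (sym (vertexAt-< v t t<N))
    (vec-inQuadrant (v (F.fromℕ< t<N))
      (subst (λ z → + 0 ≤ proj₁ z) (vertexAt-< v t t<N) (num-nonneg (N₁ N.∸ t) t (NP.m+[n∸m]≡n (N.s≤s⁻¹ t<N)))))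

  ordered : ∀ s t → s N.< t → t N.< suc N₁ → + 0 < det (V s) (V t)
  ordered s (suc t) (N.s≤s s≤t) t+1<N with NP.m≤n⇒m<n∨m≡n s≤t
  ... | inj₂ refl = subst (+ 0 <_) (sym (edge s t+1<N)) 0<1
  ... | inj₁ s<t = det-trans (V s) (V t) (V (suc t))
        (inQuadrant s (NP.<-trans s<t (NP.<⇒≤ t+1<N))) (inQuadrant t (NP.<⇒≤ t+1<N)) (inQuadrant (suc t) t+1<N)
        (ordered s t s<t (NP.<⇒≤ t+1<N)) (subst (+ 0 <_) (sym (edge t t+1<N)) 0<1)

  isNeighbourOf : ℕ → ℕ → ℕ
  isNeighbourOf j t = indicator (not (t N.≡ᵇ j) ∧ (∣ det (V j) (V t) ∣ N.≡ᵇ 1))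

  neighbours-sum : ∀ (i : Fin (suc N₁)) → farey-neighbours v i ≡ Σ< (suc N₁) (isNeighbourOf (toℕ i))
  neighbours-sum i = sum-allFin (suc N₁) _ (isNeighbourOf (toℕ i)) λ k →
    cong (λ z → indicator (not (toℕ k N.≡ᵇ toℕ i) ∧ (z N.≡ᵇ 1)))
      (cong₂ (λ a b → ∣ det a b ∣) (sym (vertexAt-toℕ v i)) (sym (vertexAt-toℕ v k)))

module Fans (N₁ : ℕ) (v : Fin (suc N₁) → Vertex) (poly : FareyPolygon (suc N₁) v) where
  open PolygonVectors N₁ v poly

  -- The fan at an interior vertex j = J + 1 with neighbours x = V J, y = V (j + 1):
  -- the neighbours of u = V j before it (read in swapped coordinates) and after it
  -- are counted by PathNeighbours along the two arcs of the polygon; the closing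
  -- edge bounds both arcs, and fan-thresholds converts the counts into det x y.
  module InteriorFan (J K : ℕ) (shape : N₁ ≡ J N.+ suc (suc K)) where
    open ≡-Reasoning

    j : ℕ
    j = suc J

    u : Vec2
    u = V j

    last-index : suc K N.+ j ≡ N₁
    last-index = trans (cong suc (NP.+-suc K J)) (sym (trans shape (NP.+-comm J (suc (suc K)))))

    j<N₁ : j N.< N₁
    j<N₁ = subst (j N.<_) last-index (N.s≤s (NP.m≤n+m j K))

    u-quad : InQuadrant u
    u-quad = inQuadrant j (N.s≤s (NP.<⇒≤ j<N₁))

    u<last : + 0 < det u (V N₁)
    u<last = ordered j N₁ j<N₁ NP.≤-refl

    first<u : + 0 < det (V 0) u
    first<u = ordered 0 j (N.s≤s N.z≤n) (N.s≤s (NP.<⇒≤ j<N₁))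

    upper : ℕ → Vec2
    upper t = swap (V (J N.∸ t))

    upper-in-range : ∀ t → J N.∸ t N.< suc N₁
    upper-in-range t = N.s≤s (NP.≤-trans (NP.m∸n≤m J t) (NP.<⇒≤ (NP.<-trans (NP.n<1+n J) j<N₁)))

    upper-edge : ∀ t → t N.< J → det (upper t) (upper (suc t)) ≡ + 1
    upper-edge t t<J = trans (det-swap (V (J N.∸ t)) (V (J N.∸ suc t)))
      (subst (λ z → det (V (J N.∸ suc t)) (V z) ≡ + 1) (sym J∸t≡)
        (edge (J N.∸ suc t) (subst (N._< suc N₁) J∸t≡ (upper-in-range t))))
      where
      J∸t≡ : J N.∸ t ≡ suc (J N.∸ suc t)
      J∸t≡ = NP.+-∸-assoc 1 t<J

    upper-after : ∀ t → t N.≤ J → + 0 < det (swap u) (upper t)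
    upper-after t _ = subst (+ 0 <_) (sym (det-swap u (V (J N.∸ t))))
      (ordered (J N.∸ t) j (N.s≤s (NP.m∸n≤m J t)) (N.s≤s (NP.<⇒≤ j<N₁)))

    -- A neighbour d of u beyond V 0 would cross the closing edge.
    upper-end : ∀ d → InQuadrant d → det (swap u) d ≡ + 1 → + 0 < det (upper J) d → ⊥
    upper-end d d-quad ud e =
      no-crossing (V N₁) u (V 0) (swap d) u<last first<u d<first d<last closing-edge ∣ud∣≡1
      where
      du : det (swap d) u ≡ + 1
      du = trans (sym (det-swap u (swap d))) ud
      d<first : + 0 < det (swap d) (V 0)
      d<first = subst (+ 0 <_) (det-swap (V 0) (swap d)) (subst (λ z → + 0 < det (swap (V z)) d) (NP.n∸n≡0 J) e)
      d<last : + 0 < det (swap d) (V N₁)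
      d<last = det-trans (swap d) u (V N₁) (inQuadrant-swap d d-quad) u-quad (inQuadrant N₁ NP.≤-refl)
                 (subst (+ 0 <_) (sym du) 0<1) u<last
      ∣ud∣≡1 : ∣ det u (swap d) ∣ ≡ 1
      ∣ud∣≡1 = trans (∣det∣-sym u (swap d)) (cong ∣_∣ du)

    module Upper = PathNeighbours (swap u) upper J (inQuadrant-swap u u-quad)
      (λ t _ → inQuadrant-swap _ (inQuadrant _ (upper-in-range t))) upper-edge upper-after
      (trans (det-swap u (V J)) (edge J (N.s≤s (NP.<⇒≤ j<N₁))))

    lower : ℕ → Vec2
    lower t = V (suc t N.+ j)

    lower-in-range : ∀ t → t N.≤ K → suc t N.+ j N.< suc N₁
    lower-in-range t t≤K = N.s≤s (subst (suc t N.+ j N.≤_) last-index (NP.+-monoˡ-≤ j (N.s≤s t≤K)))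

    lower-after : ∀ t → t N.≤ K → + 0 < det u (lower t)
    lower-after t t≤K = ordered j (suc t N.+ j) (N.s≤s (NP.m≤n+m j t)) (lower-in-range t t≤K)

    -- A neighbour d of u beyond V N₁ would cross the closing edge.
    lower-end : ∀ d → InQuadrant d → det u d ≡ + 1 → + 0 < det (lower K) d → ⊥
    lower-end d d-quad ud e = no-crossing d (V N₁) u (V 0) last<d u<last first<u first<d ∣du∣≡1 closing-edge
      where
      last<d : + 0 < det (V N₁) d
      last<d = subst (λ z → + 0 < det (V z) d) last-index e
      first<d : + 0 < det (V 0) d
      first<d = det-trans (V 0) u d (inQuadrant 0 (N.s≤s N.z≤n)) u-quad d-quad first<u (subst (+ 0 <_) (sym ud) 0<1)
      ∣du∣≡1 : ∣ det d u ∣ ≡ 1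
      ∣du∣≡1 = trans (∣det∣-sym d u) (cong ∣_∣ ud)

    module Lower = PathNeighbours u lower K u-quad (λ t t≤K → inQuadrant _ (lower-in-range t t≤K))
      (λ t t<K → edge (suc t N.+ j) (lower-in-range (suc t) t<K)) lower-after
      (edge j (N.s≤s j<N₁))

    upper-count : Σ ℕ λ m → (Σ< (suc J) Upper.isNeighbour ≡ suc m) ×
                    InQuadrant (Upper.c (+ m)) × ¬ InQuadrant (Upper.c (+ suc m))
    upper-count = Upper.count-neighbours upper-end

    lower-count : Σ ℕ λ m → (Σ< (suc K) Lower.isNeighbour ≡ suc m) ×
                    InQuadrant (Lower.c (+ m)) × ¬ InQuadrant (Lower.c (+ suc m))
    lower-count = Lower.count-neighbours lower-end

    mU : ℕ
    mU = proj₁ upper-count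

    mL : ℕ
    mL = proj₁ lower-count

    neighbours-total : (i : Fin (suc N₁)) → toℕ i ≡ j → farey-neighbours v i ≡ suc mU N.+ suc mL
    neighbours-total i i≡j = begin
      farey-neighbours v i
        ≡⟨ neighbours-sum i ⟩
      Σ< (suc N₁) (isNeighbourOf (toℕ i))
        ≡⟨ cong₂ (λ n k → Σ< n (isNeighbourOf k)) (cong suc shape) i≡j ⟩
      Σ< (j N.+ suc (suc K)) (isNeighbourOf j)
        ≡⟨ Σ<-split j (suc (suc K)) (isNeighbourOf j) ⟩
      Σ< j (isNeighbourOf j) N.+ Σ< (suc (suc K)) (λ t → isNeighbourOf j (t N.+ j))
        ≡⟨ cong₂ N._+_ (Σ<-reverse j (isNeighbourOf j)) (Σ<-shift (suc K) (λ t → isNeighbourOf j (t N.+ j))) ⟩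
      Σ< j (λ t → isNeighbourOf j (J N.∸ t)) N.+ (isNeighbourOf j j N.+ Σ< (suc K) (λ t → isNeighbourOf j (suc t N.+ j)))
        ≡⟨ cong₂ N._+_ (Σ<-cong j _ _ upper-matches) (cong₂ N._+_ self-excluded (Σ<-cong (suc K) _ _ lower-matches)) ⟩
      Σ< j Upper.isNeighbour N.+ Σ< (suc K) Lower.isNeighbour
        ≡⟨ cong₂ N._+_ (proj₁ (proj₂ upper-count)) (proj₁ (proj₂ lower-count)) ⟩
      suc mU N.+ suc mL ∎
      where
      self-excluded : isNeighbourOf j j ≡ 0
      self-excluded rewrite ≡ᵇ-refl j = refl
      upper-matches : ∀ t → t N.< j → isNeighbourOf j (J N.∸ t) ≡ Upper.isNeighbour t
      upper-matches t _ = cong₂ (λ b n → indicator (not b ∧ (n N.≡ᵇ 1)))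
        (≢⇒≡ᵇ-false (J N.∸ t) j (NP.<⇒≢ (N.s≤s (NP.m∸n≤m J t))))
        (trans (∣det∣-sym u (V (J N.∸ t))) (cong ∣_∣ (sym (det-swap u (V (J N.∸ t))))))
      lower-matches : ∀ t → t N.< suc K → isNeighbourOf j (suc t N.+ j) ≡ Lower.isNeighbour t
      lower-matches t _ = cong (λ b → indicator (not b ∧ (∣ det u (lower t) ∣ N.≡ᵇ 1)))
        (≢⇒≡ᵇ-false (suc t N.+ j) j (NP.>⇒≢ (N.s≤s (NP.m≤n+m j t))))

    xu : det (V J) u ≡ + 1
    xu = edge J (N.s≤s (NP.<⇒≤ j<N₁))

    uy : det u (V (suc j)) ≡ + 1
    uy = edge j (N.s≤s j<N₁)

    u-positive : (+ 0 < proj₁ u) × (+ 0 < proj₂ u)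
    u-positive = fan-centre-positive (V J) u (V (suc j))
      (inQuadrant J (N.s≤s (NP.<⇒≤ (NP.<-trans (NP.n<1+n J) j<N₁)))) u-quad (inQuadrant (suc j) (N.s≤s j<N₁)) xu uy

    triangles-interior : (i : Fin (suc N₁)) → toℕ i ≡ j → triangles v i ≡ det (V J) (V (suc j))
    triangles-interior i i≡j = begin
      + farey-neighbours v i - + 1  ≡⟨ cong (λ z → + z - + 1) (neighbours-total i i≡j) ⟩
      + (suc mU N.+ suc mL) - + 1  ≡⟨ count-minus-one (suc mU) mL ⟩
      + suc mU + + mL              ≡⟨ sym (fan-thresholds (V J) u (V (suc j)) mU mL u-quad
                                         (proj₁ u-positive) (proj₂ u-positive) xu uy
                                         (inQuadrant-swap _ (proj₁ (proj₂ (proj₂ upper-count))))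
                                         (λ q → proj₂ (proj₂ (proj₂ upper-count)) (inQuadrant-swap _ q))
                                         (proj₁ (proj₂ (proj₂ lower-count))) (proj₂ (proj₂ (proj₂ lower-count)))) ⟩
      det (V J) (V (suc j))        ∎

    interior-fan : (i : Fin (suc N₁)) → toℕ i ≡ j → V J ⊕ V (suc j) ≡ triangles v i · u
    interior-fan i i≡j = subst (λ T → V J ⊕ V (suc j) ≡ T · u) (sym (triangles-interior i i≡j))
      (unimodular-fan (V J) u (V (suc j)) xu uy)

  -- The fan at the first vertex ∞ of a polygon ending at 0: the neighbours of ∞
  -- are the integers V 1 = (s , 1), (s - 1 , 1), …, (0 , 1), so V 1 = (triangles at ∞ , 1).
  module EndpointFan (K : ℕ) (shape : N₁ ≡ suc K) (∞-first : V 0 ≡ (+ 1 , + 0)) (0-last : V N₁ ≡ (+ 0 , + 1)) where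

    lower-in-range : ∀ t → t N.≤ K → suc t N.< suc N₁
    lower-in-range t t≤K = N.s≤s (subst (suc t N.≤_) (sym shape) (N.s≤s t≤K))

    -- Beyond the last vertex 0 there is no vector of the quadrant.
    lower-end : ∀ d → InQuadrant d → det (V 0) d ≡ + 1 → + 0 < det (V (suc K)) d → ⊥
    lower-end (d₁ , d₂) (d₁≥0 , _) _ e = ZP.<⇒≱ (subst (+ 0 <_) (at-zero d₁ d₂) last<d) (ZP.neg-mono-≤ d₁≥0)
      where
      last<d : + 0 < det (+ 0 , + 1) (d₁ , d₂)
      last<d = subst (λ z → + 0 < det z (d₁ , d₂)) (trans (cong V (sym shape)) 0-last) e
      at-zero : ∀ a b → + 0 * b - a * + 1 ≡ - a
      at-zero = solve-∀

    module Lower = PathNeighbours (V 0) (λ t → V (suc t)) K (inQuadrant 0 (N.s≤s N.z≤n))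
      (λ t t≤K → inQuadrant (suc t) (lower-in-range t t≤K)) (λ t t<K → edge (suc t) (lower-in-range (suc t) t<K))
      (λ t t≤K → ordered 0 (suc t) (N.s≤s N.z≤n) (lower-in-range t t≤K)) (edge 0 (lower-in-range 0 N.z≤n))

    lower-count : Σ ℕ λ m → (Σ< (suc K) Lower.isNeighbour ≡ suc m) ×
                    InQuadrant (Lower.c (+ m)) × ¬ InQuadrant (Lower.c (+ suc m))
    lower-count = Lower.count-neighbours lower-end

    mL : ℕ
    mL = proj₁ lower-count

    triangles-first : triangles v zero ≡ + mL
    triangles-first = cong (λ z → + z - + 1) (begin
      farey-neighbours v zero                     ≡⟨ neighbours-sum zero ⟩
      Σ< (suc N₁) (isNeighbourOf 0)               ≡⟨ cong (λ n → Σ< (suc n) (isNeighbourOf 0)) shape ⟩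
      Σ< (suc (suc K)) (isNeighbourOf 0)          ≡⟨ Σ<-shift (suc K) (isNeighbourOf 0) ⟩
      Σ< (suc K) Lower.isNeighbour                ≡⟨ proj₁ (proj₂ lower-count) ⟩
      suc mL                                      ∎)
      where open ≡-Reasoning

    e₁ : Vec2
    e₁ = (+ 1 , + 0)

    second-vertex : V 1 ≡ (triangles v zero , + 1)
    second-vertex = cong₂ _,_ (trans s≡mL (sym triangles-first)) r≡1
      where
      s : ℤ
      s = proj₁ (V 1)
      r : ℤ
      r = proj₂ (V 1)
      r≡1 : r ≡ + 1
      r≡1 = trans (sym (on-e₁ s r)) (subst (λ z → det z (V 1) ≡ + 1) ∞-first (edge 0 (lower-in-range 0 N.z≤n)))
        where
        on-e₁ : ∀ a b → + 1 * b - a * + 0 ≡ b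
        on-e₁ = solve-∀
      -- slide (V 1) e₁ l = (s - l , 1) is in the quadrant exactly for l ≤ s.
      at-s : InQuadrant (slide (V 1) e₁ s)
      at-s = subst InQuadrant (sym (cong₂ _,_ (vanish s) (trans (keep s r) r≡1))) (ZP.≤-refl , Z.+≤+ N.z≤n , 0<1)
        where
        vanish : ∀ a → a - a * + 1 ≡ + 0
        vanish = solve-∀
        keep : ∀ a b → b - a * + 0 ≡ b
        keep = solve-∀
      beyond-s : ¬ InQuadrant (slide (V 1) e₁ (s + + 1))
      beyond-s (p , _) with subst (+ 0 ≤_) (overshoot s) p
        where
        overshoot : ∀ a → a - (a + + 1) * + 1 ≡ - + 1
        overshoot = solve-∀
      ... | ()
      s≡mL : s ≡ + mL
      s≡mL = threshold-unique (λ l → InQuadrant (slide (V 1) e₁ l))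
        (λ l l' → slide-antitone (V 1) e₁ l l' (Z.+≤+ N.z≤n , Z.+≤+ N.z≤n , 0<1))
        s (+ mL) at-s beyond-s
        (subst (λ z → InQuadrant (slide (V 1) z (+ mL))) ∞-first (proj₁ (proj₂ (proj₂ lower-count))))
        (λ q → proj₂ (proj₂ (proj₂ lower-count)) (subst (λ z → InQuadrant (slide (V 1) z (+ suc mL))) (sym ∞-first)
                  (subst (λ z → InQuadrant (slide (V 1) e₁ (+ z))) (NP.+-comm mL 1) q)))

  fan : (T : ℕ → ℤ) → (∀ i → triangles v i ≡ T (toℕ i)) →
    ∀ t → suc (suc t) N.< suc N₁ → V t ⊕ V (suc (suc t)) ≡ T (suc t) · V (suc t)
  fan T triangles≡T t t+2<N = subst (λ z → V t ⊕ V (suc (suc t)) ≡ z · V (suc t))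
    (trans (triangles≡T i) (cong T toℕ-i)) (InteriorFan.interior-fan t (N₁ N.∸ suc (suc t)) shape i toℕ-i)
    where
    t+1<N : suc t N.< suc N₁
    t+1<N = NP.<⇒≤ t+2<N
    i : Fin (suc N₁)
    i = F.fromℕ< t+1<N
    toℕ-i : toℕ i ≡ suc t
    toℕ-i = FP.toℕ-fromℕ< t+1<N
    shape : N₁ ≡ t N.+ suc (suc (N₁ N.∸ suc (suc t)))
    shape = sym (trans (NP.+-suc t (suc (N₁ N.∸ suc (suc t))))
              (trans (cong suc (NP.+-suc t (N₁ N.∸ suc (suc t)))) (NP.m+[n∸m]≡n (N.s≤s⁻¹ t+2<N))))

recurrence-agree : ∀ N (c f g : ℕ → ℤ) →
  (∀ t → suc (suc t) N.< N → f (suc (suc t)) ≡ c (suc t) * f (suc t) - f t) →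
  (∀ t → suc (suc t) N.< N → g t + g (suc (suc t)) ≡ c (suc t) * g (suc t)) →
  f 0 ≡ g 0 → f 1 ≡ g 1 → ∀ t → t N.< N → f t ≡ g t
recurrence-agree N c f g f-rec g-rec f0≡g0 f1≡g1 = agree
  where
  open ≡-Reasoning
  cancel : ∀ a b → (a + b) - a ≡ b
  cancel = solve-∀
  agree-pair : ∀ t → suc t N.< N → (f t ≡ g t) × (f (suc t) ≡ g (suc t))
  agree-pair N.zero _ = f0≡g0 , f1≡g1
  agree-pair (suc t) t+2<N with agree-pair t (NP.<⇒≤ t+2<N)
  ... | (ft≡gt , ft+1≡gt+1) = ft+1≡gt+1 , (begin
    f (suc (suc t))                     ≡⟨ f-rec t t+2<N ⟩
    c (suc t) * f (suc t) - f t         ≡⟨ cong₂ (λ x y → c (suc t) * x - y) ft+1≡gt+1 ft≡gt ⟩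
    c (suc t) * g (suc t) - g t         ≡⟨ cong (_- g t) (sym (g-rec t t+2<N)) ⟩
    (g t + g (suc (suc t))) - g t       ≡⟨ cancel (g t) (g (suc (suc t))) ⟩
    g (suc (suc t))                     ∎)
  agree : ∀ t → t N.< N → f t ≡ g t
  agree N.zero _ = f0≡g0
  agree (suc t) t+1<N = proj₂ (agree-pair t t+1<N)

recurrence-at-ℕ : (b c : ℤ → ℤ) → (∀ j → b (j + + 1) ≡ c j * b j - b (j - + 1)) →
  ∀ t → b (+ suc (suc t)) ≡ c (+ suc t) * b (+ suc t) - b (+ t)
recurrence-at-ℕ b c rec t = trans (cong (λ z → b (+ z)) (NP.+-comm 1 (suc t))) (rec (+ suc t))

-- Rows 0 and 1 of the array are the vectors of the polygon v: both satisfy the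
-- recurrence with coefficients q, by the fan relation, and they agree at 0 and 1.
first-rows : ∀ n' (a : ℤ → ℤ → ℤ) (q : ℤ → ℤ) → (∀ i j → a i (j + + 1) ≡ q j * a i j - a i (j - + 1)) →
  (v : Fin (suc (suc n')) → Vertex) → FareyPolygon (suc (suc n')) v →
  vec (v zero) ≡ (a (+ 0) (+ 0) , a (+ 1) (+ 0)) → vec (v (suc zero)) ≡ (a (+ 0) (+ 1) , a (+ 1) (+ 1)) →
  (∀ j → triangles v j ≡ q (+ toℕ j)) →
  ∀ t → t N.< suc (suc n') → (a (+ 0) (+ t) , a (+ 1) (+ t)) ≡ vertexAt v t
first-rows n' a q rec v poly v₀ v₁ triangles≡q t t<N =
  cong₂ _,_ (row proj₁ (+ 0) (λ s s+2<N → cong proj₁ (fan-q s s+2<N)) (cong proj₁ first) (cong proj₁ second))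
            (row proj₂ (+ 1) (λ s s+2<N → cong proj₂ (fan-q s s+2<N)) (cong proj₂ first) (cong proj₂ second))
  where
  open PolygonVectors (suc n') v poly using (V)
  open Fans (suc n') v poly using (fan)
  fan-q : ∀ s → suc (suc s) N.< suc (suc n') → V s ⊕ V (suc (suc s)) ≡ q (+ suc s) · V (suc s)
  fan-q = fan (λ s → q (+ s)) triangles≡q
  first : (a (+ 0) (+ 0) , a (+ 1) (+ 0)) ≡ V 0
  first = sym (trans (vertexAt-toℕ v zero) v₀)
  second : (a (+ 0) (+ 1) , a (+ 1) (+ 1)) ≡ V 1
  second = sym (trans (vertexAt-toℕ v (suc zero)) v₁)
  row : (π : Vec2 → ℤ) (r : ℤ) →
    (∀ s → suc (suc s) N.< suc (suc n') → π (V s) + π (V (suc (suc s))) ≡ q (+ suc s) * π (V (suc s))) →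
    a r (+ 0) ≡ π (V 0) → a r (+ 1) ≡ π (V 1) → a r (+ t) ≡ π (V t)
  row π r fan-π e₀ e₁ = recurrence-agree (suc (suc n')) (λ s → q (+ s)) (λ s → a r (+ s)) (λ s → π (V s))
    (λ s _ → recurrence-at-ℕ (a r) q (rec r) s) fan-π e₀ e₁ t t<N

-- Column entries b (i + 1) are the determinants det (w i) z, where w runs through
-- a polygon from ∞ to 0 and z = (b 0 , b 1): both sides satisfy the recurrence with
-- coefficients c (i + 1), the endpoint fan gives w 1 = (c 1 , 1), and they agree at 0 and 1.
columns : ∀ m' (b c : ℤ → ℤ) → (∀ i → b (i + + 1) ≡ c i * b i - b (i - + 1)) →
  (w : Fin (suc (suc m')) → Vertex) → FareyPolygon (suc (suc m')) w →
  vertexAt w 0 ≡ (+ 1 , + 0) → vertexAt w (suc m') ≡ (+ 0 , + 1) →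
  (∀ i → triangles w i ≡ c (+ toℕ i + + 1)) →
  ∀ k → k N.< suc (suc m') → b (+ suc k) ≡ det (vertexAt w k) (b (+ 0) , b (+ 1))
columns m' b c rec w poly ∞-first 0-last triangles≡c =
  recurrence-agree (suc (suc m')) (λ k → c (+ suc k)) (λ k → b (+ suc k)) (λ k → det (W k) z)
    (λ k _ → recurrence-at-ℕ b c rec (suc k))
    (λ k k+2<N → det-linear (W k) (W (suc (suc k))) (W (suc k)) z (c (+ suc (suc k))) (fan-c k k+2<N))
    first second
  where
  open ≡-Reasoning
  open PolygonVectors (suc m') w poly using () renaming (V to W)
  open Fans (suc m') w poly using (fan; module EndpointFan)
  z : Vec2
  z = (b (+ 0) , b (+ 1))
  fan-c : ∀ k → suc (suc k) N.< suc (suc m') → W k ⊕ W (suc (suc k)) ≡ c (+ suc (suc k)) · W (suc k)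
  fan-c = fan (λ k → c (+ suc k)) (λ i → trans (triangles≡c i) (cong (λ n → c (+ n)) (NP.+-comm (toℕ i) 1)))
  W₁ : W 1 ≡ (c (+ 1) , + 1)
  W₁ = trans (EndpointFan.second-vertex m' refl ∞-first 0-last) (cong (_, + 1) (triangles≡c zero))
  first : b (+ 1) ≡ det (W 0) z
  first = sym (trans (cong (λ x → det x z) ∞-first) (on-e₁ (b (+ 0)) (b (+ 1))))
    where
    on-e₁ : ∀ p r → + 1 * r - p * + 0 ≡ r
    on-e₁ = solve-∀
  second : b (+ 2) ≡ det (W 1) z
  second = begin
    b (+ 2)                                  ≡⟨ recurrence-at-ℕ b c rec 0 ⟩
    c (+ 1) * b (+ 1) - b (+ 0)              ≡⟨ sym (on-W₁ (c (+ 1)) (b (+ 0)) (b (+ 1))) ⟩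
    det (c (+ 1) , + 1) z                    ≡⟨ cong (λ x → det x z) (sym W₁) ⟩
    det (W 1) z                              ∎
    where
    on-W₁ : ∀ T p r → T * r - p * + 1 ≡ T * r - p
    on-W₁ = solve-∀

theorem7p1 : (n' m' : ℕ) →
    (a : ℤ → ℤ → ℤ) →
    (∀ i j → a i j * a (i + + 1) (j + + 1) - a i (j + + 1) * a (i + + 1) j ≡ + 1) →
    (∀ i j → a i (j + + suc (suc n')) ≡ - a i j) →
    (∀ i j → a (i + + suc (suc m')) j ≡ - a i j) →
    (∀ (i : Fin (suc (suc m'))) (j : Fin (suc (suc n'))) → + 0 < a (+ toℕ i) (+ toℕ j)) →
    (q q' : ℤ → ℤ) →
    (∀ j → q (j + + suc (suc n')) ≡ q j) →
    (∀ i → q' (i + + suc (suc m')) ≡ q' i) →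
    (∀ i j → a i (j + + 1) ≡ q j * a i j - a i (j - + 1)) →
    (∀ i j → a (i + + 1) j ≡ q' i * a i j - a (i - + 1) j) →
    (v : Fin (suc (suc n')) → Vertex) → FareyPolygon (suc (suc n')) v →
    num (v zero) ≡ a (+ 0) (+ 0) → + den (v zero) ≡ a (+ 1) (+ 0) →
    num (v (suc zero)) ≡ a (+ 0) (+ 1) → + den (v (suc zero)) ≡ a (+ 1) (+ 1) →
    (∀ (j : Fin (suc (suc n'))) → triangles v j ≡ q (+ toℕ j)) →
    (v' : Fin (suc (suc m')) → Vertex) → FareyPolygon (suc (suc m')) v' →
    num (v' zero) ≡ + 1 → den (v' zero) ≡ 0 →
    num (v' (fromℕ (suc m'))) ≡ + 0 → den (v' (fromℕ (suc m'))) ≡ 1 →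
    (∀ (i : Fin (suc (suc m'))) → triangles v' i ≡ q' (+ toℕ i + + 1)) →
    ∀ (i : Fin (suc (suc m'))) (j : Fin (suc (suc n'))) → a (+ toℕ i) (+ toℕ j) ≡ + fareyDist (v' (prevIdx i)) (v j)
theorem7p1 n' m' a _ _ _ positive q q' _ _ rec-q rec-q' v poly v₀-num v₀-den v₁-num v₁-den triangles≡q
  v' poly' ∞-num ∞-den 0-num 0-den triangles≡q' i j = pos-±⇒∣∣ _ _ (positive i j) (entry i)
  where
  open ≡-Reasoning
  column : (a (+ 0) (+ toℕ j) , a (+ 1) (+ toℕ j)) ≡ vec (v j)
  column = trans (first-rows n' a q rec-q v poly (cong₂ _,_ v₀-num v₀-den) (cong₂ _,_ v₁-num v₁-den) triangles≡q
                   (toℕ j) (FP.toℕ<n j))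
                 (vertexAt-toℕ v j)
  ∞-first : vertexAt v' 0 ≡ (+ 1 , + 0)
  ∞-first = trans (vertexAt-toℕ v' zero) (cong₂ _,_ ∞-num (cong +_ ∞-den))
  0-vertex : vec (v' (fromℕ (suc m'))) ≡ (+ 0 , + 1)
  0-vertex = cong₂ _,_ 0-num (cong +_ 0-den)
  0-last : vertexAt v' (suc m') ≡ (+ 0 , + 1)
  0-last = trans (vertexAt-index v' (fromℕ (suc m')) (suc m') (FP.toℕ-fromℕ (suc m'))) 0-vertex
  -- Row 0 holds the numerators, i.e. minus the determinants against v'₋₁ = 0;
  -- row i + 1 holds the determinants against v'ᵢ.
  entry : ∀ i → (a (+ toℕ i) (+ toℕ j) ≡ det (vec (v' (prevIdx i))) (vec (v j)))
              ⊎ (a (+ toℕ i) (+ toℕ j) ≡ - det (vec (v' (prevIdx i))) (vec (v j)))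
  entry zero = inj₂ (begin
    a (+ 0) (+ toℕ j)                            ≡⟨ cong proj₁ column ⟩
    num (v j)                                    ≡⟨ sym (against-0 (num (v j)) (+ den (v j))) ⟩
    - det (+ 0 , + 1) (vec (v j))                ≡⟨ cong (λ x → - det x (vec (v j))) (sym 0-vertex) ⟩
    - det (vec (v' (fromℕ (suc m')))) (vec (v j)) ∎)
    where
    against-0 : ∀ p r → - (+ 0 * r - p * + 1) ≡ p
    against-0 = solve-∀
  entry (suc i₀) = inj₁ (trans
    (columns m' (λ r → a r (+ toℕ j)) q' (λ r → rec-q' r (+ toℕ j)) v' poly' ∞-first 0-last triangles≡q'
      (toℕ i₀) (NP.m<n⇒m<1+n (FP.toℕ<n i₀)))
    (cong₂ det (vertexAt-index v' (F.inject₁ i₀) (toℕ i₀) (FP.toℕ-inject₁ i₀)) column))
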